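{- Let $\mathbb F$ be a finite field of odd order and $Q=Q_{a,b}$ a quadratic quasigroup upon $\mathbb F$. If $\operatorname{char}(\mathbb F)=3$, then $Q$ is a Steiner quasigroup if and only if $a=b=-1$, and in that case $Q$ is induced by an affine Steiner triple system (its triples $\{x,y,x*y\}$, $x\ne y$, are the lines of $\mathbb F$ regarded as an affine space over $\mathbb F_3$). If $\operatorname{char}(\mathbb F)\ne3$, then $Q$ is a Steiner quasigroup if and only if $ab=1=a+b$ and $-1$ is a nonsquare; in that case $a\ne b$, $ab=a+b=a-a^2=b-b^2=-a^3=-b^3=1$ and $\chi(a)=\chi(b)=\chi(1-a)=\chi(1-b)=\chi(-1)=-1$. Furthermore, if $Q_{a,b}$ is a Steiner quasigroup with $a\ne b$, then for a quadratic quasigroup $Q_{c,d}$ upon $\mathbb F$ with $c\ne d$, $Q_{c,d}$ is a Steiner quasigroup if and only if $\{a,b\}=\{c,d\}$, and in that case $Q_{a,b}\cong Q_{c,d}$.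
   Context: $\chi$ is the quadratic character of $\mathbb F$ ($\chi(0)=0$, $1$ on nonzero squares, $-1$ on nonsquares). For $a,b\in\mathbb F$ with $\chi(a)=\chi(b)\ne0$ and $\chi(1-a)=\chi(1-b)\ne0$, $Q_{a,b}$ is $(\mathbb F,*)$ with $x*y=x+a(y-x)$ if $\chi(y-x)\ge0$ and $x*y=x+b(y-x)$ if $\chi(y-x)=-1$. A Steiner quasigroup is a quasigroup that is idempotent ($xx=x$), commutative and semisymmetric ($(xy)x=y$). -}

module Defs where

open import Level using (0ℓ)
open import Data.Nat as ℕ using (ℕ)
open import Data.Nat.Properties as ℕP using ()
open import Data.Fin as Fin using (Fin)
open import Data.Fin.Properties as FinP using (any?)
open import Data.Integer as ℤ using (ℤ; +_; -[1+_])
open import Data.Bool using (if_then_else_)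
open import Data.Product using (Σ; ∃; _×_; _,_; proj₁; proj₂)
open import Data.Sum using (_⊎_)
open import Function using (_∘_)
open import Function.Bundles using (_↔_; Inverse; _⇔_)
open import Relation.Nullary using (¬_; Dec; yes; no)
open import Relation.Nullary.Decidable using (⌊_⌋; map′)
open import Relation.Binary.PropositionalEquality
open import Algebra.Structures using (IsCommutativeRing)

record FiniteField : Set₁ where
  infixl 7 _*_
  infixl 6 _+_ _-_
  infix  8 -_
  field
    Carrier : Set
    _+_ _*_ : Carrier → Carrier → Carrier
    -_      : Carrier → Carrier
    0# 1#   : Carrier
    isCommutativeRing : IsCommutativeRing _≡_ _+_ _*_ -_ 0# 1#
    0≢1     : ¬ (0# ≡ 1#)
    inverse : ∀ x → ¬ (x ≡ 0#) → ∃ λ y → x * y ≡ 1#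
    size    : ℕ
    enum    : Carrier ↔ Fin size

  _-_ : Carrier → Carrier → Carrier
  x - y = x + (- y)

  _≟_ : (x y : Carrier) → Dec (x ≡ y)
  x ≟ y = map′ inj (cong to) (to x FinP.≟ to y)
    where
    open Inverse enum
    inj : to x ≡ to y → x ≡ y
    inj e = trans (sym (strictlyInverseʳ x))
                  (trans (cong from e) (strictlyInverseʳ y))

  IsSquare : Carrier → Set
  IsSquare x = ∃ λ y → y * y ≡ x

  isSquare? : (x : Carrier) → Dec (IsSquare x)
  isSquare? x = map′ (λ { (i , e) → from i , e })
                     (λ { (y , e) → to y , trans (cong₂ _*_ (strictlyInverseʳ y) (strictlyInverseʳ y)) e })
                     (any? (λ i → (from i * from i) ≟ x))
    where open Inverse enum

  χ : Carrier → ℤ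
  χ x with x ≟ 0#
  ... | yes _ = + 0
  ... | no  _ with isSquare? x
  ...   | yes _ = + 1
  ...   | no  _ = -[1+ 0 ]

  Char3 : Set
  Char3 = 1# + 1# + 1# ≡ 0#

  OddOrder : Set
  OddOrder = size ℕ.% 2 ≡ 1



module _ (F : FiniteField) where
  open FiniteField F using (Carrier; _+_; _*_; _-_; -_; 0#; 1#; χ)

  QuadParams : Carrier → Carrier → Set
  QuadParams a b = χ a ≡ χ b × ¬ (χ a ≡ + 0)
                 × χ (1# - a) ≡ χ (1# - b) × ¬ (χ (1# - a) ≡ + 0)

  qmul : Carrier → Carrier → Carrier → Carrier → Carrier
  qmul a b x y =
    if ⌊ χ (y - x) ℤ.≟ -[1+ 0 ] ⌋ then x + b * (y - x) else x + a * (y - x)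

module _ {A : Set} (_∙_ : A → A → A) where

  IsQuasigroup : Set
  IsQuasigroup =
    (∀ a b → ∃ λ x → (a ∙ x ≡ b) × (∀ x′ → a ∙ x′ ≡ b → x′ ≡ x)) ×
    (∀ a b → ∃ λ y → (y ∙ a ≡ b) × (∀ y′ → y′ ∙ a ≡ b → y′ ≡ y))

  IsSteiner : Set
  IsSteiner = IsQuasigroup
            × (∀ x → x ∙ x ≡ x)
            × (∀ x y → x ∙ y ≡ y ∙ x)
            × (∀ x y → (x ∙ y) ∙ x ≡ y)

_≅M_ : {A : Set} → (A → A → A) → (A → A → A) → Set
_≅M_ {A} _∙_ _∘′_ = Σ (A ↔ A) λ f →
  ∀ x y → Inverse.to f (x ∙ y) ≡ Inverse.to f x ∘′ Inverse.to f y

SamePair : {A : Set} → A → A → A → A → Set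
SamePair a b c d = (a ≡ c × b ≡ d) ⊎ (a ≡ d × b ≡ c)

-- In characteristic 3: the triple {x, y, x∙y} (x ≠ y) is the line of F,
-- viewed as an affine space over F_3, through x and y, i.e. the set
-- {x + t(y - x) : t ∈ F_3} = {x, y, x + 2(y - x)}.
module _ (F : FiniteField) where
  open FiniteField F using (Carrier; _+_; _*_; _-_; 1#)

  InducedByAffineSTS : (Carrier → Carrier → Carrier) → Set
  InducedByAffineSTS _∙_ =
    ∀ x y → ¬ (x ≡ y) → x ∙ y ≡ x + (1# + 1#) * (y - x)

{-# OPTIONS --safe #-}

-- Commutativity and semisymmetry evaluated at 0, 1, a (and at a
-- nonsquare) force a + b = 1 and a - a² = 1 when -1 is a nonsquare; when -1 is
-- a square they force 2a = 1 = a - a², possible only in characteristic 3, and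
-- then a = b = -1.  Conversely, if -1 is a nonsquare, an affine map z ↦ c z + t
-- with nonsquare slope c exchanges the roles of a and b: for c = -1 this gives
-- the isomorphism Q_{a,b} ≅ Q_{b,a} and, with a + b = 1, commutativity, while
-- semisymmetry follows from a - a² = 1 because -a is a square.  Finally a and b
-- are the two roots of t² - t + 1, which pins down the pair {a, b}.

module Submission where

open import Level using (0ℓ)
open import Algebra.Bundles using (CommutativeRing)
import Algebra.Properties.Ring as RingProperties
import Algebra.Properties.Semiring.Mult.TCOptimised as SemiringMultiples
import Algebra.Solver.Ring
import Algebra.Solver.Ring.AlmostCommutativeRing as ACR
open import Data.Empty using (⊥; ⊥-elim)
open import Data.Fin as Fin using (Fin)
import Data.Fin.Properties as FinP
open import Data.Sign as Sign using ()
open import Data.Integer as ℤ using (ℤ; +_; -[1+_])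
import Data.Integer.Properties as ℤP
import Data.Maybe as Maybe
open import Data.Nat as ℕ using (zero; suc)
import Data.Nat.Properties as ℕP
open import Data.Product using (∃; _×_; _,_; proj₁; proj₂)
open import Data.Sum using (_⊎_; inj₁; inj₂)
open import Function using (_∘_)
open import Function.Bundles using (_↔_; Inverse; Injection; Equivalence; _⇔_; mk⇔; mk↔ₛ′)
open import Function.Properties.Inverse using (↔⇒↣; ↔-sym; ↔-refl)
open import Function.Definitions using (Injective; StrictlySurjective)
open import Relation.Binary.PropositionalEquality
open import Relation.Nullary using (¬_; yes; no)
open import Relation.Nullary.Decidable using (¬?; dec⇒maybe)

open import Defs

commutative∧semisymmetric⇒quasigroup : ∀ {A : Set} (_∙_ : A → A → A) →
  (∀ x y → x ∙ y ≡ y ∙ x) → (∀ x y → (x ∙ y) ∙ x ≡ y) → IsQuasigroup _∙_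
commutative∧semisymmetric⇒quasigroup _∙_ comm semi = left , right
  where
  left : ∀ p c → ∃ λ x → (p ∙ x ≡ c) × (∀ x′ → p ∙ x′ ≡ c → x′ ≡ x)
  left p c = p ∙ c , trans (comm p (p ∙ c)) (semi p c) ,
    λ x′ px′≡c → trans (sym (semi p x′)) (trans (cong (_∙ p) px′≡c) (comm c p))
  right : ∀ p c → ∃ λ y → (y ∙ p ≡ c) × (∀ y′ → y′ ∙ p ≡ c → y′ ≡ y)
  right p c = p ∙ c , semi p c , λ y′ y′p≡c → proj₂ (proj₂ (left p c)) y′ (trans (comm p y′) y′p≡c)

Fin-injective⇒surjective : ∀ {n} (h : Fin n → Fin n) → Injective _≡_ _≡_ h → StrictlySurjective _≡_ h
Fin-injective⇒surjective {zero}  h h-inj ()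
Fin-injective⇒surjective {suc n} h h-inj j with FinP.any? (λ i → h i FinP.≟ j)
... | yes hit = hit
... | no miss = ⊥-elim (FinP.<⇒notInjective (ℕP.n<1+n n) h′-inj)
  where
  j≢h : ∀ i → j ≢ h i
  j≢h i j≡hi = miss (i , sym j≡hi)
  h′ : Fin (suc n) → Fin n
  h′ i = Fin.punchOut (j≢h i)
  h′-inj : Injective _≡_ _≡_ h′
  h′-inj {i} {i′} eq = h-inj (FinP.punchOut-injective (j≢h i) (j≢h i′) eq)

↔Fin⇒injective⇒surjective : ∀ {A : Set} {n} → A ↔ Fin n →
  (f : A → A) → Injective _≡_ _≡_ f → StrictlySurjective _≡_ f
↔Fin⇒injective⇒surjective {n = n} enum f f-inj y
  with Fin-injective⇒surjective h h-inj (to y)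
  where
  open Inverse enum
  h : Fin n → Fin n
  h i = to (f (from i))
  h-inj : Injective _≡_ _≡_ h
  h-inj eq = Injection.injective (↔⇒↣ (↔-sym enum)) (f-inj (Injection.injective (↔⇒↣ enum) eq))
... | i , hi≡y = Inverse.from enum i , Injection.injective (↔⇒↣ enum) hi≡y

module FieldProperties (F : FiniteField) where
  open FiniteField F

  commutativeRing : CommutativeRing 0ℓ 0ℓ
  commutativeRing = record { isCommutativeRing = isCommutativeRing }

  module R = CommutativeRing commutativeRing
  module RP = RingProperties R.ring
  open SemiringMultiples R.semiring using (1+×; ×-homo-+; ×1-homo-*) renaming (_×_ to _×′_)

  -- Integer coefficients for the ring solver, read in F as n ×′ 1#.  These
  -- type-checking-optimised multiples make con (+ 3) literally 1# + 1# + 1#.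
  private
    ⟦_⟧ℤ : ℤ → Carrier
    ⟦ + n ⟧ℤ      = n ×′ 1#
    ⟦ -[1+ n ] ⟧ℤ = - (suc n ×′ 1#)

    ⊖-homo : ∀ m n → ⟦ m ℤ.⊖ n ⟧ℤ ≡ m ×′ 1# - n ×′ 1#
    ⊖-homo m zero = begin
      ⟦ m ℤ.⊖ 0 ⟧ℤ ≡⟨ cong ⟦_⟧ℤ (ℤP.⊖-≥ {m} ℕ.z≤n) ⟩
      m ×′ 1#      ≡⟨ sym (R.+-identityʳ _) ⟩
      m ×′ 1# + 0# ≡⟨ cong (_+_ (m ×′ 1#)) (sym RP.-0#≈0#) ⟩
      m ×′ 1# - 0# ∎
      where open ≡-Reasoning
    ⊖-homo zero (suc n) = sym (R.+-identityˡ _)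
    ⊖-homo (suc m) (suc n) = begin
      ⟦ suc m ℤ.⊖ suc n ⟧ℤ            ≡⟨ cong ⟦_⟧ℤ (ℤP.[1+m]⊖[1+n]≡m⊖n m n) ⟩
      ⟦ m ℤ.⊖ n ⟧ℤ                    ≡⟨ ⊖-homo m n ⟩
      m ×′ 1# - n ×′ 1#               ≡⟨ sym (shift 1# (m ×′ 1#) (n ×′ 1#)) ⟩
      (1# + m ×′ 1#) - (1# + n ×′ 1#) ≡⟨ sym (cong₂ _-_ (1+× m 1#) (1+× n 1#)) ⟩
      suc m ×′ 1# - suc n ×′ 1#       ∎
      where
      open ≡-Reasoning
      shift : ∀ x y z → (x + y) - (x + z) ≡ y - z
      shift x y z = begin
        (x + y) - (x + z)      ≡⟨ cong (_+_ (x + y)) (sym (RP.-‿+-comm x z)) ⟩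
        (x + y) + (- x - z)    ≡⟨ R.+-assoc x y _ ⟩
        x + (y + (- x - z))    ≡⟨ cong (_+_ x) (sym (R.+-assoc y (- x) (- z))) ⟩
        x + ((y - x) - z)      ≡⟨ cong (λ w → x + (w - z)) (R.+-comm y (- x)) ⟩
        x + ((- x + y) - z)    ≡⟨ cong (_+_ x) (R.+-assoc (- x) y (- z)) ⟩
        x + (- x + (y - z))    ≡⟨ sym (R.+-assoc x (- x) _) ⟩
        (x - x) + (y - z)      ≡⟨ cong (_+ (y - z)) (R.-‿inverseʳ x) ⟩
        0# + (y - z)           ≡⟨ R.+-identityˡ _ ⟩
        y - z                  ∎

    +-homo : ∀ i j → ⟦ i ℤ.+ j ⟧ℤ ≡ ⟦ i ⟧ℤ + ⟦ j ⟧ℤ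
    +-homo (+ m)    (+ n)    = ×-homo-+ 1# m n
    +-homo (+ m)    -[1+ n ] = ⊖-homo m (suc n)
    +-homo -[1+ m ] (+ n)    = trans (⊖-homo n (suc m)) (R.+-comm _ _)
    +-homo -[1+ m ] -[1+ n ] = begin
      - (suc (suc (m ℕ.+ n)) ×′ 1#)   ≡⟨ cong (λ k → - (k ×′ 1#)) (sym (ℕP.+-suc (suc m) n)) ⟩
      - ((suc m ℕ.+ suc n) ×′ 1#)     ≡⟨ cong -_ (×-homo-+ 1# (suc m) (suc n)) ⟩
      - (suc m ×′ 1# + suc n ×′ 1#)   ≡⟨ sym (RP.-‿+-comm _ _) ⟩
      - (suc m ×′ 1#) - (suc n ×′ 1#) ∎
      where open ≡-Reasoning

    -‿homo : ∀ i → ⟦ ℤ.- i ⟧ℤ ≡ - ⟦ i ⟧ℤ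
    -‿homo (+ zero)  = sym RP.-0#≈0#
    -‿homo (+ suc n) = refl
    -‿homo -[1+ n ]  = sym (RP.-‿involutive _)

    +◃-homo : ∀ n → ⟦ Sign.+ ℤ.◃ n ⟧ℤ ≡ n ×′ 1#
    +◃-homo zero    = refl
    +◃-homo (suc n) = refl

    -◃-homo : ∀ n → ⟦ Sign.- ℤ.◃ n ⟧ℤ ≡ - (n ×′ 1#)
    -◃-homo zero    = sym RP.-0#≈0#
    -◃-homo (suc n) = refl

    *-homo : ∀ i j → ⟦ i ℤ.* j ⟧ℤ ≡ ⟦ i ⟧ℤ * ⟦ j ⟧ℤ
    *-homo (+ m) (+ n) =
      trans (+◃-homo (m ℕ.* n)) (×1-homo-* m n)
    *-homo (+ m) -[1+ n ] =
      trans (-◃-homo (m ℕ.* suc n)) (trans (cong -_ (×1-homo-* m (suc n))) (RP.-‿distribʳ-* _ _))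
    *-homo -[1+ m ] (+ n) =
      trans (-◃-homo (suc m ℕ.* n)) (trans (cong -_ (×1-homo-* (suc m) n)) (RP.-‿distribˡ-* _ _))
    *-homo -[1+ m ] -[1+ n ] =
      trans (×1-homo-* (suc m) (suc n)) (sym (-x*-y≡x*y _ _))
      where
      -x*-y≡x*y : ∀ x y → - x * - y ≡ x * y
      -x*-y≡x*y x y = begin
        - x * - y     ≡⟨ sym (RP.-‿distribˡ-* x (- y)) ⟩
        - (x * - y)   ≡⟨ cong -_ (sym (RP.-‿distribʳ-* x y)) ⟩
        - - (x * y)   ≡⟨ RP.-‿involutive _ ⟩
        x * y         ∎
        where open ≡-Reasoning

    characteristicMap : ℤ.+-*-rawRing ACR.-Raw-AlmostCommutative⟶ ACR.fromCommutativeRing commutativeRing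
    characteristicMap = record
      { ⟦_⟧ = ⟦_⟧ℤ ; +-homo = +-homo ; *-homo = *-homo ; -‿homo = -‿homo
      ; 0-homo = refl ; 1-homo = refl }

  open Algebra.Solver.Ring ℤ.+-*-rawRing (ACR.fromCommutativeRing commutativeRing) characteristicMap
    (λ i j → Maybe.map (cong ⟦_⟧ℤ) (dec⇒maybe (i ℤ.≟ j)))
    using (Polynomial; solve; _:=_; _:+_; _:-_; _:*_; :-_; con) public

  0ₚ 1ₚ : ∀ {n} → Polynomial n
  0ₚ = con (+ 0)
  1ₚ = con (+ 1)

  x-y≡0⇒x≡y : ∀ {x y} → x - y ≡ 0# → x ≡ y
  x-y≡0⇒x≡y = RP.x∙y⁻¹≈ε⇒x≈y _ _

  x≡y⇒x-y≡0 : ∀ {x y} → x ≡ y → x - y ≡ 0#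
  x≡y⇒x-y≡0 {x} refl = R.-‿inverseʳ x

  x+y≡1⇒1-x≡y : ∀ {x y} → x + y ≡ 1# → 1# - x ≡ y
  x+y≡1⇒1-x≡y {x} {y} x+y≡1 = trans (cong (_- x) (sym x+y≡1)) (solve 2 (λ x y → (x :+ y) :- x := y) refl x y)

  -‿≢0 : ∀ {x} → x ≢ 0# → - x ≢ 0#
  -‿≢0 {x} x≢0 -x≡0 = x≢0 (trans (sym (RP.-‿involutive x)) (trans (cong -_ -x≡0) RP.-0#≈0#))

  x*y≡0⇒x≡0∨y≡0 : ∀ {x y} → x * y ≡ 0# → x ≡ 0# ⊎ y ≡ 0#
  x*y≡0⇒x≡0∨y≡0 {x} {y} xy≡0 with x ≟ 0#
  ... | yes x≡0 = inj₁ x≡0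
  ... | no x≢0 with inverse x x≢0
  ...   | x⁻¹ , xx⁻¹≡1 = inj₂ (begin
    y                ≡⟨ solve 1 (λ y → y := 1ₚ :* y) refl y ⟩
    1# * y           ≡⟨ cong (_* y) (sym xx⁻¹≡1) ⟩
    (x * x⁻¹) * y    ≡⟨ solve 3 (λ x x⁻¹ y → (x :* x⁻¹) :* y := x⁻¹ :* (x :* y)) refl x x⁻¹ y ⟩
    x⁻¹ * (x * y)    ≡⟨ cong (x⁻¹ *_) xy≡0 ⟩
    x⁻¹ * 0#         ≡⟨ R.zeroʳ x⁻¹ ⟩
    0#               ∎)
    where open ≡-Reasoning

  x*x≡0⇒x≡0 : ∀ {x} → x * x ≡ 0# → x ≡ 0#
  x*x≡0⇒x≡0 x²≡0 with x*y≡0⇒x≡0∨y≡0 x²≡0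
  ... | inj₁ x≡0 = x≡0
  ... | inj₂ x≡0 = x≡0

  *-cancelˡ-≡ : ∀ {x y z} → x ≢ 0# → x * y ≡ x * z → y ≡ z
  *-cancelˡ-≡ {x} {y} {z} x≢0 xy≡xz with x*y≡0⇒x≡0∨y≡0 x[y-z]≡0
    where
    x[y-z]≡0 : x * (y - z) ≡ 0#
    x[y-z]≡0 = trans (RP.x[y-z]≈xy-xz x y z) (x≡y⇒x-y≡0 xy≡xz)
  ... | inj₁ x≡0   = ⊥-elim (x≢0 x≡0)
  ... | inj₂ y-z≡0 = x-y≡0⇒x≡y y-z≡0

  x*x≡y*y⇒x≡±y : ∀ {x y} → x * x ≡ y * y → x ≡ y ⊎ x ≡ - y
  x*x≡y*y⇒x≡±y {x} {y} xx≡yy with x*y≡0⇒x≡0∨y≡0 [x-y][x+y]≡0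
    where
    [x-y][x+y]≡0 : (x - y) * (x + y) ≡ 0#
    [x-y][x+y]≡0 = trans (solve 2 (λ x y → (x :- y) :* (x :+ y) := x :* x :- y :* y) refl x y)
                         (x≡y⇒x-y≡0 xx≡yy)
  ... | inj₁ x-y≡0 = inj₁ (x-y≡0⇒x≡y x-y≡0)
  ... | inj₂ x+y≡0 = inj₂ (x-y≡0⇒x≡y (trans (cong (_+_ x) (RP.-‿involutive y)) x+y≡0))

  0-square : IsSquare 0#
  0-square = 0# , R.zeroˡ 0#

  1-square : IsSquare 1#
  1-square = 1# , R.*-identityˡ 1#

  square-* : ∀ {x y} → IsSquare x → IsSquare y → IsSquare (x * y)
  square-* {x} {y} (s , s²≡x) (t , t²≡y) =
    s * t , trans (solve 2 (λ s t → (s :* t) :* (s :* t) := (s :* s) :* (t :* t)) refl s t)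
                  (cong₂ _*_ s²≡x t²≡y)

  nonsquare⇒≢0 : ∀ {x} → ¬ IsSquare x → x ≢ 0#
  nonsquare⇒≢0 ns refl = ns 0-square

  square*nonsquare⇒nonsquare : ∀ {x y} → IsSquare x → x ≢ 0# → ¬ IsSquare y → ¬ IsSquare (x * y)
  square*nonsquare⇒nonsquare {x} {y} (t , t²≡x) x≢0 ns (r , r²≡xy) with t ≟ 0#
  ... | yes t≡0 = x≢0 (trans (sym t²≡x) (trans (cong (λ t → t * t) t≡0) (R.zeroˡ 0#)))
  ... | no t≢0 with inverse t t≢0
  ...   | t⁻¹ , tt⁻¹≡1 = ns (r * t⁻¹ , (begin
    (r * t⁻¹) * (r * t⁻¹)          ≡⟨ solve 2 (λ r t⁻¹ → (r :* t⁻¹) :* (r :* t⁻¹) := (r :* r) :* (t⁻¹ :* t⁻¹)) refl r t⁻¹ ⟩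
    (r * r) * (t⁻¹ * t⁻¹)          ≡⟨ cong (_* (t⁻¹ * t⁻¹)) (trans r²≡xy (cong (_* y) (sym t²≡x))) ⟩
    ((t * t) * y) * (t⁻¹ * t⁻¹)    ≡⟨ solve 3 (λ t y t⁻¹ → ((t :* t) :* y) :* (t⁻¹ :* t⁻¹) := ((t :* t⁻¹) :* (t :* t⁻¹)) :* y) refl t y t⁻¹ ⟩
    ((t * t⁻¹) * (t * t⁻¹)) * y    ≡⟨ cong (λ u → (u * u) * y) tt⁻¹≡1 ⟩
    (1# * 1#) * y                  ≡⟨ solve 1 (λ y → (1ₚ :* 1ₚ) :* y := y) refl y ⟩
    y                              ∎))
    where open ≡-Reasoning

  open Inverse enum using (to; from; strictlyInverseʳ)

  nonsquare-exists : 1# ≢ - 1# → ∃ λ w → ¬ IsSquare w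
  nonsquare-exists 1≢-1 with FinP.any? (λ i → ¬? (isSquare? (from i)))
  ... | yes (i , ns) = from i , ns
  ... | no none = ⊥-elim (1≢-1 (trans (sym (√1≡ 1# (R.*-identityˡ 1#))) (√1≡ (- 1#) -1*-1≡1)))
    where
    every-square : ∀ x → IsSquare x
    every-square x with isSquare? x
    ... | yes sq = sq
    ... | no ns = ⊥-elim (none (to x , subst (λ y → ¬ IsSquare y) (sym (strictlyInverseʳ x)) ns))
    √ : Carrier → Carrier
    √ x = proj₁ (every-square x)
    √²≡ : ∀ x → √ x * √ x ≡ x
    √²≡ x = proj₂ (every-square x)
    √-inj : Injective _≡_ _≡_ √
    √-inj {x} {y} eq = trans (sym (√²≡ x)) (trans (cong (λ z → z * z) eq) (√²≡ y))
    √1≡ : ∀ r → r * r ≡ 1# → √ 1# ≡ r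
    √1≡ r r²≡1 with ↔Fin⇒injective⇒surjective enum √ √-inj r
    ... | u , √u≡r = subst (λ v → √ v ≡ r) u≡1 √u≡r
      where
      u≡1 : u ≡ 1#
      u≡1 = trans (sym (√²≡ u)) (trans (cong (λ z → z * z) √u≡r) r²≡1)
    -1*-1≡1 : - 1# * - 1# ≡ 1#
    -1*-1≡1 = solve 0 ((:- 1ₚ) :* (:- 1ₚ) := 1ₚ) refl

  -- Keeping one element of each pair ±x, the map sending the kept x to x² and
  -- the others to n x² is injective, hence onto.
  module _ {n : Carrier} (ns-n : ¬ IsSquare n) where
    private
      Kept : Carrier → Set
      Kept x = to x Fin.< to (- x)

      ι : Carrier → Carrier
      ι x with to x FinP.<? to (- x)
      ... | yes _ = x * x
      ... | no _  = n * (x * x)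

      ι-view : ∀ x → (Kept x × ι x ≡ x * x) ⊎ (¬ Kept x × ι x ≡ n * (x * x))
      ι-view x with to x FinP.<? to (- x)
      ... | yes kept = inj₁ (kept , refl)
      ... | no ¬kept = inj₂ (¬kept , refl)

      -x≡y : ∀ {x y} → x ≡ - y → - x ≡ y
      -x≡y {y = y} refl = RP.-‿involutive y

      kept-unique : ∀ {x y} → Kept x → Kept y → x * x ≡ y * y → x ≡ y
      kept-unique {x} {y} kx ky x²≡y² with x*x≡y*y⇒x≡±y x²≡y²
      ... | inj₁ x≡y  = x≡y
      ... | inj₂ x≡-y = ⊥-elim (FinP.<-asym (subst (λ z → to x Fin.< to z) (-x≡y x≡-y) kx)
                                            (subst (λ z → to y Fin.< to z) (sym x≡-y) ky))

      unkept-unique : ∀ {x y} → ¬ Kept x → ¬ Kept y → x * x ≡ y * y → x ≡ y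
      unkept-unique {x} {y} ux uy x²≡y² with x*x≡y*y⇒x≡±y x²≡y²
      ... | inj₁ x≡y  = x≡y
      ... | inj₂ x≡-y = Injection.injective (↔⇒↣ enum) (FinP.≤-antisym
          (ℕP.≮⇒≥ (subst (λ z → ¬ to y Fin.< to z) (sym x≡-y) uy))
          (ℕP.≮⇒≥ (subst (λ z → ¬ to x Fin.< to z) (-x≡y x≡-y) ux)))

      kept≢unkept : ∀ {x y} → Kept x → x * x ≢ n * (y * y)
      kept≢unkept {x} {y} kx x²≡ny² with y ≟ 0#
      ... | yes refl = FinP.<-irrefl (cong to (sym -x≡x)) kx
        where
        x≡0 : x ≡ 0#
        x≡0 = x*x≡0⇒x≡0 (trans x²≡ny² (trans (cong (n *_) (R.zeroˡ 0#)) (R.zeroʳ n)))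
        -x≡x : - x ≡ x
        -x≡x = trans (cong -_ x≡0) (trans RP.-0#≈0# (sym x≡0))
      ... | no y≢0 = square*nonsquare⇒nonsquare (y , refl) (λ y²≡0 → y≢0 (x*x≡0⇒x≡0 y²≡0)) ns-n
                       (x , trans x²≡ny² (R.*-comm n (y * y)))

      ι-inj : Injective _≡_ _≡_ ι
      ι-inj {x} {y} ιx≡ιy with ι-view x | ι-view y
      ... | inj₁ (kx , ιx≡) | inj₁ (ky , ιy≡) = kept-unique kx ky (trans (sym ιx≡) (trans ιx≡ιy ιy≡))
      ... | inj₂ (ux , ιx≡) | inj₂ (uy , ιy≡) =
        unkept-unique ux uy (*-cancelˡ-≡ (nonsquare⇒≢0 ns-n) (trans (sym ιx≡) (trans ιx≡ιy ιy≡)))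
      ... | inj₁ (kx , ιx≡) | inj₂ (_ , ιy≡) = ⊥-elim (kept≢unkept kx (trans (sym ιx≡) (trans ιx≡ιy ιy≡)))
      ... | inj₂ (_ , ιx≡) | inj₁ (ky , ιy≡) = ⊥-elim (kept≢unkept ky (trans (sym ιy≡) (trans (sym ιx≡ιy) ιx≡)))

    nonsquare≡n*square : ∀ {y} → ¬ IsSquare y → ∃ λ x → n * (x * x) ≡ y
    nonsquare≡n*square {y} ns-y with ↔Fin⇒injective⇒surjective enum ι ι-inj y
    ... | x , ιx≡y with ι-view x
    ...   | inj₁ (_ , ιx≡) = ⊥-elim (ns-y (x , trans (sym ιx≡) ιx≡y))
    ...   | inj₂ (_ , ιx≡) = x , trans (sym ιx≡) ιx≡y

  nonsquare*nonsquare⇒square : ∀ {n y} → ¬ IsSquare n → ¬ IsSquare y → IsSquare (n * y)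
  nonsquare*nonsquare⇒square {n} {y} ns-n ns-y with nonsquare≡n*square ns-n ns-y
  ... | x , nx²≡y = n * x , (begin
    (n * x) * (n * x)     ≡⟨ solve 2 (λ n x → (n :* x) :* (n :* x) := n :* (n :* (x :* x))) refl n x ⟩
    n * (n * (x * x))     ≡⟨ cong (n *_) nx²≡y ⟩
    n * y                 ∎)
    where open ≡-Reasoning

  -1-nonsquare⇒-‿square : ¬ IsSquare (- 1#) → ∀ {x} → ¬ IsSquare x → IsSquare (- x)
  -1-nonsquare⇒-‿square ns {x} ns-x = subst IsSquare (RP.-1*x≈-x x) (nonsquare*nonsquare⇒square ns ns-x)

  -1-square⇒-‿nonsquare : IsSquare (- 1#) → ∀ {x} → ¬ IsSquare x → ¬ IsSquare (- x)
  -1-square⇒-‿nonsquare sq {x} ns-x =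
    subst (λ y → ¬ IsSquare y) (RP.-1*x≈-x x) (square*nonsquare⇒nonsquare sq (-‿≢0 1≢0) ns-x)
    where
    1≢0 : 1# ≢ 0#
    1≢0 1≡0 = 0≢1 (sym 1≡0)

  χ≡-1⇒nonsquare : ∀ {x} → χ x ≡ -[1+ 0 ] → ¬ IsSquare x
  χ≡-1⇒nonsquare {x} with x ≟ 0#
  ... | yes _ = λ ()
  ... | no _ with isSquare? x
  ...   | yes _  = λ ()
  ...   | no ns  = λ _ → ns

  nonsquare⇒χ≡-1 : ∀ {x} → ¬ IsSquare x → χ x ≡ -[1+ 0 ]
  nonsquare⇒χ≡-1 {x} ns with x ≟ 0#
  ... | yes refl = ⊥-elim (ns 0-square)
  ... | no _ with isSquare? x
  ...   | yes sq = ⊥-elim (ns sq)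
  ...   | no _   = refl

  χ≢0⇒≢0 : ∀ {x} → χ x ≢ + 0 → x ≢ 0#
  χ≢0⇒≢0 {x} with x ≟ 0#
  ... | yes _   = λ χx≢0 _ → χx≢0 refl
  ... | no x≢0  = λ _ → x≢0

  4≡1⇒Char3 : 1# + 1# + 1# + 1# ≡ 1# → Char3
  4≡1⇒Char3 4≡1 = x-y≡0⇒x≡y (trans (solve 0 (con (+ 3) :- 0ₚ := con (+ 4) :- 1ₚ) refl) (x≡y⇒x-y≡0 4≡1))

  Char3⇒2≡-1 : Char3 → 1# + 1# ≡ - 1#
  Char3⇒2≡-1 3≡0 = begin
    1# + 1#           ≡⟨ solve 0 (con (+ 2) := con (+ 3) :- 1ₚ) refl ⟩
    1# + 1# + 1# - 1# ≡⟨ cong (_- 1#) 3≡0 ⟩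
    0# - 1#           ≡⟨ R.+-identityˡ (- 1#) ⟩
    - 1#              ∎
    where open ≡-Reasoning

  Char3⇒1≢-1 : Char3 → 1# ≢ - 1#
  Char3⇒1≢-1 3≡0 1≡-1 = 0≢1 (begin
    0#                ≡⟨ sym 3≡0 ⟩
    1# + 1# + 1#      ≡⟨ cong (λ z → 1# + z + 1#) 1≡-1 ⟩
    1# - 1# + 1#      ≡⟨ solve 0 (1ₚ :- 1ₚ :+ 1ₚ := 1ₚ) refl ⟩
    1#                ∎)
    where open ≡-Reasoning

  Char3⇒x+x≡1⇒x≡-1 : Char3 → ∀ {x} → x + x ≡ 1# → x ≡ - 1#
  Char3⇒x+x≡1⇒x≡-1 3≡0 {x} 2x≡1 = begin
    x                             ≡⟨ solve 1 (λ x → x := con (+ 3) :* x :- (x :+ x)) refl x ⟩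
    (1# + 1# + 1#) * x - (x + x)  ≡⟨ cong₂ (λ t u → t * x - u) 3≡0 2x≡1 ⟩
    0# * x - 1#                   ≡⟨ solve 1 (λ x → 0ₚ :* x :- 1ₚ := :- 1ₚ) refl x ⟩
    - 1#                          ∎
    where open ≡-Reasoning


module QuadraticQuasigroupProperties (F : FiniteField) where
  open FiniteField F
  open FieldProperties F

  qmul-square : ∀ a b {x y d} → y - x ≡ d → IsSquare d → qmul F a b x y ≡ x + a * d
  qmul-square a b {x} {y} refl sq with χ (y - x) ℤ.≟ -[1+ 0 ]
  ... | yes χ≡-1 = ⊥-elim (χ≡-1⇒nonsquare χ≡-1 sq)
  ... | no _     = refl

  qmul-nonsquare : ∀ a b {x y d} → y - x ≡ d → ¬ IsSquare d → qmul F a b x y ≡ x + b * d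
  qmul-nonsquare a b {x} {y} refl ns with χ (y - x) ℤ.≟ -[1+ 0 ]
  ... | yes _     = refl
  ... | no χ≢-1   = ⊥-elim (χ≢-1 (nonsquare⇒χ≡-1 ns))

  qmul-idem : ∀ a b x → qmul F a b x x ≡ x
  qmul-idem a b x = trans (qmul-square a b (R.-‿inverseʳ x) 0-square)
                          (solve 2 (λ x a → x :+ a :* 0ₚ := x) refl x a)

  qmul-uniform : ∀ k x y → qmul F k k x y ≡ x + k * (y - x)
  qmul-uniform k x y with isSquare? (y - x)
  ... | yes sq = qmul-square k k refl sq
  ... | no ns  = qmul-nonsquare k k refl ns

  private
    complementary-steps : ∀ {k k′} → k + k′ ≡ 1# → ∀ x y → (x + k * (y - x)) + (x + k′ * (y - x)) ≡ x + y
    complementary-steps {k} {k′} k+k′≡1 x y = begin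
      (x + k * (y - x)) + (x + k′ * (y - x))  ≡⟨ solve 4 (λ x y k k′ → (x :+ k :* (y :- x)) :+ (x :+ k′ :* (y :- x))
                                                   := x :+ (k :+ k′) :* (y :- x) :+ x) refl x y k k′ ⟩
      x + (k + k′) * (y - x) + x              ≡⟨ cong (λ s → x + s * (y - x) + x) k+k′≡1 ⟩
      x + 1# * (y - x) + x                    ≡⟨ solve 2 (λ x y → x :+ 1ₚ :* (y :- x) :+ x := x :+ y) refl x y ⟩
      x + y                                   ∎
      where open ≡-Reasoning

  qmul-complement : ∀ {a b} → a + b ≡ 1# → ∀ x y → qmul F a b x y + qmul F b a x y ≡ x + y
  qmul-complement {a} {b} a+b≡1 x y with isSquare? (y - x)
  ... | yes sq = trans (cong₂ _+_ (qmul-square a b refl sq) (qmul-square b a refl sq))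
                       (complementary-steps a+b≡1 x y)
  ... | no ns  = trans (cong₂ _+_ (qmul-nonsquare a b refl ns) (qmul-nonsquare b a refl ns))
                       (complementary-steps (trans (R.+-comm b a) a+b≡1) x y)

  private
    affine-diff : ∀ c t x y → (c * y + t) - (c * x + t) ≡ (y - x) * c
    affine-diff c t x y = solve 4 (λ c t x y → (c :* y :+ t) :- (c :* x :+ t) := (y :- x) :* c) refl c t x y

    affine-step : ∀ c t k x y → c * x + t + k * ((y - x) * c) ≡ c * (x + k * (y - x)) + t
    affine-step c t k x y =
      solve 5 (λ c t k x y → c :* x :+ t :+ k :* ((y :- x) :* c) := c :* (x :+ k :* (y :- x)) :+ t) refl c t k x y

  -- Multiplying differences by a nonsquare exchanges their square classes.
  qmul-affine-nonsquare : ∀ a b {c} → ¬ IsSquare c → ∀ t x y →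
    qmul F a b (c * x + t) (c * y + t) ≡ c * qmul F b a x y + t
  qmul-affine-nonsquare a b {c} ns-c t x y with x ≟ y
  ... | yes refl = trans (qmul-idem a b (c * x + t)) (cong (λ z → c * z + t) (sym (qmul-idem b a x)))
  ... | no x≢y with isSquare? (y - x)
  ...   | yes sq = begin
    qmul F a b (c * x + t) (c * y + t)  ≡⟨ qmul-nonsquare a b (affine-diff c t x y)
                                             (square*nonsquare⇒nonsquare sq y-x≢0 ns-c) ⟩
    c * x + t + b * ((y - x) * c)       ≡⟨ affine-step c t b x y ⟩
    c * (x + b * (y - x)) + t           ≡⟨ cong (λ z → c * z + t) (sym (qmul-square b a refl sq)) ⟩
    c * qmul F b a x y + t              ∎
    where
    open ≡-Reasoning
    y-x≢0 : y - x ≢ 0#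
    y-x≢0 y-x≡0 = x≢y (sym (x-y≡0⇒x≡y y-x≡0))
  ...   | no ns = begin
    qmul F a b (c * x + t) (c * y + t)  ≡⟨ qmul-square a b (affine-diff c t x y)
                                             (nonsquare*nonsquare⇒square ns ns-c) ⟩
    c * x + t + a * ((y - x) * c)       ≡⟨ affine-step c t a x y ⟩
    c * (x + a * (y - x)) + t           ≡⟨ cong (λ z → c * z + t) (sym (qmul-nonsquare b a refl ns)) ⟩
    c * qmul F b a x y + t              ∎
    where open ≡-Reasoning

  -- The point reflection z ↦ (x + y) - z exchanges x and y.
  qmul-comm : ∀ {a b} → ¬ IsSquare (- 1#) → a + b ≡ 1# → ∀ x y → qmul F a b x y ≡ qmul F a b y x
  qmul-comm {a} {b} ns a+b≡1 x y = begin
    p                                                     ≡⟨ solve 2 (λ p q → p := :- 1ₚ :* q :+ (p :+ q)) refl p q ⟩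
    - 1# * q + (p + q)                                    ≡⟨ cong (_+_ (- 1# * q)) (qmul-complement a+b≡1 x y) ⟩
    - 1# * q + (x + y)                                    ≡⟨ sym (qmul-affine-nonsquare a b ns (x + y) x y) ⟩
    qmul F a b (- 1# * x + (x + y)) (- 1# * y + (x + y))  ≡⟨ cong₂ (qmul F a b) -x+[x+y]≡y -y+[x+y]≡x ⟩
    qmul F a b y x                                        ∎
    where
    open ≡-Reasoning
    p q : Carrier
    p = qmul F a b x y
    q = qmul F b a x y
    -x+[x+y]≡y : - 1# * x + (x + y) ≡ y
    -x+[x+y]≡y = solve 2 (λ x y → :- 1ₚ :* x :+ (x :+ y) := y) refl x y
    -y+[x+y]≡x : - 1# * y + (x + y) ≡ x
    -y+[x+y]≡x = solve 2 (λ x y → :- 1ₚ :* y :+ (x :+ y) := x) refl x y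

  qmul-swap-≅ : ∀ a b → ¬ IsSquare (- 1#) → qmul F a b ≅M qmul F b a
  qmul-swap-≅ a b ns = mk↔ₛ′ -_ -_ RP.-‿involutive RP.-‿involutive , -‿homo
    where
    -1*z+0≡-z : ∀ z → - 1# * z + 0# ≡ - z
    -1*z+0≡-z = solve 1 (λ z → :- 1ₚ :* z :+ 0ₚ := :- z) refl
    -‿homo : ∀ x y → - qmul F a b x y ≡ qmul F b a (- x) (- y)
    -‿homo x y = begin
      - qmul F a b x y                            ≡⟨ sym (-1*z+0≡-z _) ⟩
      - 1# * qmul F a b x y + 0#                  ≡⟨ sym (qmul-affine-nonsquare b a ns 0# x y) ⟩
      qmul F b a (- 1# * x + 0#) (- 1# * y + 0#)  ≡⟨ cong₂ (qmul F b a) (-1*z+0≡-z x) (-1*z+0≡-z y) ⟩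
      qmul F b a (- x) (- y)                      ∎
      where open ≡-Reasoning

  module SumProductOne {u v : Carrier} (u+v≡1 : u + v ≡ 1#) (u*v≡1 : u * v ≡ 1#) where

    1-u≡v : 1# - u ≡ v
    1-u≡v = x+y≡1⇒1-x≡y u+v≡1

    1-v≡u : 1# - v ≡ u
    1-v≡u = x+y≡1⇒1-x≡y (trans (R.+-comm v u) u+v≡1)

    u-u*u≡1 : u - u * u ≡ 1#
    u-u*u≡1 = begin
      u - u * u      ≡⟨ solve 1 (λ u → u :- u :* u := u :* (1ₚ :- u)) refl u ⟩
      u * (1# - u)   ≡⟨ cong (u *_) 1-u≡v ⟩
      u * v          ≡⟨ u*v≡1 ⟩
      1#             ∎
      where open ≡-Reasoning

    u*u*u≡-1 : u * u * u ≡ - 1#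
    u*u*u≡-1 = x-y≡0⇒x≡y (begin
      u * u * u - - 1#               ≡⟨ solve 1 (λ u → u :* u :* u :- :- 1ₚ := (1ₚ :- (u :- u :* u)) :* (u :+ 1ₚ)) refl u ⟩
      (1# - (u - u * u)) * (u + 1#)  ≡⟨ cong (λ z → (1# - z) * (u + 1#)) u-u*u≡1 ⟩
      (1# - 1#) * (u + 1#)           ≡⟨ solve 1 (λ u → (1ₚ :- 1ₚ) :* (u :+ 1ₚ) := 0ₚ) refl u ⟩
      0#                             ∎)
      where open ≡-Reasoning

    -u*u*u≡1 : - (u * u * u) ≡ 1#
    -u*u*u≡1 = trans (cong -_ u*u*u≡-1) (RP.-‿involutive 1#)

    -1-nonsquare⇒nonsquare : ¬ IsSquare (- 1#) → ¬ IsSquare u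
    -1-nonsquare⇒nonsquare ns (t , t*t≡u) = ns (t * u , (begin
      (t * u) * (t * u)  ≡⟨ solve 2 (λ t u → (t :* u) :* (t :* u) := (t :* t) :* u :* u) refl t u ⟩
      (t * t) * u * u    ≡⟨ cong (λ z → z * u * u) t*t≡u ⟩
      u * u * u          ≡⟨ u*u*u≡-1 ⟩
      - 1#               ∎))
      where open ≡-Reasoning

    x+ud+u[-ud]≡x+d : ∀ x d → (x + u * d) + u * (- u * d) ≡ x + d
    x+ud+u[-ud]≡x+d x d = begin
      (x + u * d) + u * (- u * d)  ≡⟨ solve 3 (λ x d u → (x :+ u :* d) :+ u :* (:- u :* d) := x :+ (u :- u :* u) :* d) refl x d u ⟩
      x + (u - u * u) * d          ≡⟨ cong (λ z → x + z * d) u-u*u≡1 ⟩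
      x + 1# * d                   ≡⟨ cong (_+_ x) (R.*-identityˡ d) ⟩
      x + d                        ∎
      where open ≡-Reasoning

    Char3⇒u≡-1 : Char3 → u ≡ - 1#
    Char3⇒u≡-1 3≡0 = x-y≡0⇒x≡y (trans (solve 1 (λ u → u :- :- 1ₚ := u :+ 1ₚ) refl u) (x*x≡0⇒x≡0 (begin
      (u + 1#) * (u + 1#)                       ≡⟨ solve 2 (λ u v → (u :+ 1ₚ) :* (u :+ 1ₚ)
                                                      := u :* (u :+ v) :- u :* v :+ con (+ 2) :* u :+ 1ₚ) refl u v ⟩
      u * (u + v) - u * v + (1# + 1#) * u + 1#  ≡⟨ cong₂ (λ s p → u * s - p + (1# + 1#) * u + 1#) u+v≡1 u*v≡1 ⟩
      u * 1# - 1# + (1# + 1#) * u + 1#          ≡⟨ solve 1 (λ u → u :* 1ₚ :- 1ₚ :+ con (+ 2) :* u :+ 1ₚ := con (+ 3) :* u) refl u ⟩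
      (1# + 1# + 1#) * u                        ≡⟨ cong (_* u) 3≡0 ⟩
      0# * u                                    ≡⟨ R.zeroˡ u ⟩
      0#                                        ∎)))
      where open ≡-Reasoning

    ¬Char3⇒u≢v : ¬ Char3 → u ≢ v
    ¬Char3⇒u≢v ¬3≡0 refl = ¬3≡0 (4≡1⇒Char3 (begin
      1# + 1# + 1# + 1#              ≡⟨ solve 0 (con (+ 4) := con (+ 4) :* 1ₚ) refl ⟩
      (1# + 1# + 1# + 1#) * 1#       ≡⟨ cong (_*_ (1# + 1# + 1# + 1#)) (sym u*v≡1) ⟩
      (1# + 1# + 1# + 1#) * (u * u)  ≡⟨ solve 1 (λ u → con (+ 4) :* (u :* u) := (u :+ u) :* (u :+ u)) refl u ⟩
      (u + u) * (u + u)              ≡⟨ cong (λ s → s * s) u+v≡1 ⟩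
      1# * 1#                        ≡⟨ R.*-identityˡ 1# ⟩
      1#                             ∎))
      where open ≡-Reasoning

    -- c, like u and v, is a root of t² - t + 1.
    pair-unique : ∀ {c d} → c + d ≡ 1# → c * d ≡ 1# → SamePair u v c d
    pair-unique {c} {d} c+d≡1 c*d≡1 with x*y≡0⇒x≡0∨y≡0 [c-u][c-v]≡0
      where
      open ≡-Reasoning
      [c-u][c-v]≡0 : (c - u) * (c - v) ≡ 0#
      [c-u][c-v]≡0 = begin
        (c - u) * (c - v)                          ≡⟨ solve 4 (λ u v c d → (c :- u) :* (c :- v)
                                                        := c :* (c :+ d) :- c :* d :- (u :+ v) :* c :+ u :* v) refl u v c d ⟩
        c * (c + d) - c * d - (u + v) * c + u * v  ≡⟨ cong₂ (λ s p → c * s - p - (u + v) * c + u * v) c+d≡1 c*d≡1 ⟩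
        c * 1# - 1# - (u + v) * c + u * v          ≡⟨ cong₂ (λ s p → c * 1# - 1# - s * c + p) u+v≡1 u*v≡1 ⟩
        c * 1# - 1# - 1# * c + 1#                  ≡⟨ solve 1 (λ c → c :* 1ₚ :- 1ₚ :- 1ₚ :* c :+ 1ₚ := 0ₚ) refl c ⟩
        0#                                         ∎
    ... | inj₁ c-u≡0 = inj₁ (sym c≡u , trans (sym 1-u≡v) (trans (cong (_-_ 1#) (sym c≡u)) (x+y≡1⇒1-x≡y c+d≡1)))
      where
      c≡u : c ≡ u
      c≡u = x-y≡0⇒x≡y c-u≡0
    ... | inj₂ c-v≡0 = inj₂ (trans (sym 1-v≡u) (trans (cong (_-_ 1#) (sym c≡v)) (x+y≡1⇒1-x≡y c+d≡1)) , sym c≡v)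
      where
      c≡v : c ≡ v
      c≡v = x-y≡0⇒x≡y c-v≡0

  steiner-of-roots : ∀ {a b} → a + b ≡ 1# → a * b ≡ 1# → ¬ IsSquare (- 1#) → IsSteiner (qmul F a b)
  steiner-of-roots {a} {b} a+b≡1 a*b≡1 ns =
    commutative∧semisymmetric⇒quasigroup _ comm semi , qmul-idem a b , comm , semi
    where
    module A = SumProductOne a+b≡1 a*b≡1
    module B = SumProductOne (trans (R.+-comm b a) a+b≡1) (trans (R.*-comm b a) a*b≡1)

    comm : ∀ x y → qmul F a b x y ≡ qmul F a b y x
    comm = qmul-comm ns a+b≡1

    back : ∀ k x y → x - (x + k * (y - x)) ≡ - k * (y - x)
    back k x y = solve 3 (λ k x y → x :- (x :+ k :* (y :- x)) := :- k :* (y :- x)) refl k x y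

    x+[y-x]≡y : ∀ x y → x + (y - x) ≡ y
    x+[y-x]≡y x y = solve 2 (λ x y → x :+ (y :- x) := y) refl x y

    -a-square : IsSquare (- a)
    -a-square = -1-nonsquare⇒-‿square ns (A.-1-nonsquare⇒nonsquare ns)

    -b-square : IsSquare (- b)
    -b-square = -1-nonsquare⇒-‿square ns (B.-1-nonsquare⇒nonsquare ns)

    semi : ∀ x y → qmul F a b (qmul F a b x y) x ≡ y
    semi x y with isSquare? (y - x)
    ... | yes sq = begin
      qmul F a b (qmul F a b x y) x         ≡⟨ cong (λ z → qmul F a b z x) (qmul-square a b refl sq) ⟩
      qmul F a b (x + a * (y - x)) x        ≡⟨ qmul-square a b (back a x y) (square-* -a-square sq) ⟩
      x + a * (y - x) + a * (- a * (y - x)) ≡⟨ A.x+ud+u[-ud]≡x+d x (y - x) ⟩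
      x + (y - x)                           ≡⟨ x+[y-x]≡y x y ⟩
      y                                     ∎
      where open ≡-Reasoning
    ... | no ns-d = begin
      qmul F a b (qmul F a b x y) x         ≡⟨ cong (λ z → qmul F a b z x) (qmul-nonsquare a b refl ns-d) ⟩
      qmul F a b (x + b * (y - x)) x        ≡⟨ qmul-nonsquare a b (back b x y)
                                                 (square*nonsquare⇒nonsquare -b-square
                                                   (-‿≢0 (nonsquare⇒≢0 (B.-1-nonsquare⇒nonsquare ns))) ns-d) ⟩
      x + b * (y - x) + b * (- b * (y - x)) ≡⟨ B.x+ud+u[-ud]≡x+d x (y - x) ⟩
      x + (y - x)                           ≡⟨ x+[y-x]≡y x y ⟩
      y                                     ∎
      where open ≡-Reasoning

  qmul-char3 : Char3 → ∀ x y → qmul F (- 1#) (- 1#) x y ≡ - (x + y)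
  qmul-char3 3≡0 x y = begin
    qmul F (- 1#) (- 1#) x y          ≡⟨ qmul-uniform (- 1#) x y ⟩
    x + - 1# * (y - x)                ≡⟨ solve 2 (λ x y → x :+ :- 1ₚ :* (y :- x) := con (+ 3) :* x :- (x :+ y)) refl x y ⟩
    (1# + 1# + 1#) * x - (x + y)      ≡⟨ cong (λ t → t * x - (x + y)) 3≡0 ⟩
    0# * x - (x + y)                  ≡⟨ solve 2 (λ x y → 0ₚ :* x :- (x :+ y) := :- (x :+ y)) refl x y ⟩
    - (x + y)                         ∎
    where open ≡-Reasoning

  steiner-char3 : Char3 → IsSteiner (qmul F (- 1#) (- 1#))
  steiner-char3 3≡0 =
    commutative∧semisymmetric⇒quasigroup _ comm semi , qmul-idem (- 1#) (- 1#) , comm , semi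
    where
    comm : ∀ x y → qmul F (- 1#) (- 1#) x y ≡ qmul F (- 1#) (- 1#) y x
    comm x y = trans (qmul-char3 3≡0 x y) (trans (cong -_ (R.+-comm x y)) (sym (qmul-char3 3≡0 y x)))
    semi : ∀ x y → qmul F (- 1#) (- 1#) (qmul F (- 1#) (- 1#) x y) x ≡ y
    semi x y = trans (qmul-char3 3≡0 _ x) (trans (cong (λ z → - (z + x)) (qmul-char3 3≡0 x y))
                      (solve 2 (λ x y → :- ((:- (x :+ y)) :+ x) := y) refl x y))

  affine-char3 : Char3 → InducedByAffineSTS F (qmul F (- 1#) (- 1#))
  affine-char3 3≡0 x y _ = trans (qmul-uniform (- 1#) x y) (cong (λ k → x + k * (y - x)) (sym (Char3⇒2≡-1 3≡0)))

  module Necessity {a b : Carrier} (a≢1 : a ≢ 1#) (b-nonsquare : ¬ IsSquare a → ¬ IsSquare b)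
                   (comm : ∀ x y → qmul F a b x y ≡ qmul F a b y x)
                   (semi : ∀ x y → qmul F a b (qmul F a b x y) x ≡ y) where

    private
      0∙1≡a : qmul F a b 0# 1# ≡ a
      0∙1≡a = trans (qmul-square a b (solve 0 (1ₚ :- 0ₚ := 1ₚ) refl) 1-square)
                    (solve 1 (λ a → 0ₚ :+ a :* 1ₚ := a) refl a)

      a∙0≡1 : qmul F a b a 0# ≡ 1#
      a∙0≡1 = trans (cong (λ z → qmul F a b z 0#) (sym 0∙1≡a)) (semi 0# 1#)

      0-x≡-x : ∀ x → 0# - x ≡ - x
      0-x≡-x = R.+-identityˡ ∘ -_

      -- a = 1∙0 = 1 + k (0 - 1), k being a or b according to the class of -1.
      1-k≡a : ∀ {k} → qmul F a b 1# 0# ≡ 1# + k * - 1# → 1# - k ≡ a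
      1-k≡a {k} 1∙0≡ = trans (solve 1 (λ k → 1ₚ :- k := 1ₚ :+ k :* :- 1ₚ) refl k)
                             (trans (sym 1∙0≡) (trans (comm 1# 0#) 0∙1≡a))

    a+b≡1 : ¬ IsSquare (- 1#) → a + b ≡ 1#
    a+b≡1 ns = trans (cong (_+ b) (sym (1-k≡a (qmul-nonsquare a b (0-x≡-x 1#) ns))))
                     (solve 1 (λ b → 1ₚ :- b :+ b := 1ₚ) refl b)

    a+a≡1 : IsSquare (- 1#) → a + a ≡ 1#
    a+a≡1 sq = trans (cong (_+ a) (sym (1-k≡a (qmul-square a b (0-x≡-x 1#) sq))))
                     (solve 1 (λ a → 1ₚ :- a :+ a := 1ₚ) refl a)

    private
      a+b*[-a]≡1 : ¬ IsSquare (- a) → a + b * - a ≡ 1#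
      a+b*[-a]≡1 ns-a = trans (sym (qmul-nonsquare a b (0-x≡-x a) ns-a)) a∙0≡1

      -- Otherwise a² = a + (1 - a)(-a) = 1, yet a ≠ 1 and -a is not 1.
      -1-nonsquare⇒-a-square : ¬ IsSquare (- 1#) → IsSquare (- a)
      -1-nonsquare⇒-a-square ns with isSquare? (- a)
      ... | yes sq-a = sq-a
      ... | no ns-a  = ⊥-elim (a≢±1 (x*x≡y*y⇒x≡±y (begin
        a * a                ≡⟨ solve 1 (λ a → a :* a := a :+ (1ₚ :- a) :* :- a) refl a ⟩
        a + (1# - a) * - a   ≡⟨ cong (λ k → a + k * - a) (x+y≡1⇒1-x≡y (a+b≡1 ns)) ⟩
        a + b * - a          ≡⟨ a+b*[-a]≡1 ns-a ⟩
        1#                   ≡⟨ sym (R.*-identityˡ 1#) ⟩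
        1# * 1#              ∎)))
        where
        open ≡-Reasoning
        a≢±1 : a ≡ 1# ⊎ a ≡ - 1# → ⊥
        a≢±1 (inj₁ a≡1)  = a≢1 a≡1
        a≢±1 (inj₂ a≡-1) = ns-a (subst IsSquare (sym (trans (cong -_ a≡-1) (RP.-‿involutive 1#))) 1-square)

      -- Otherwise a, hence b, is a nonsquare, yet 1 - b = 2a(1 - b) = 2(a + b(-a)) = 2 makes b = -1 a square.
      -1-square⇒-a-square : IsSquare (- 1#) → IsSquare (- a)
      -1-square⇒-a-square sq with isSquare? (- a)
      ... | yes sq-a = sq-a
      ... | no ns-a  = ⊥-elim (b-nonsquare ns-a′ (subst IsSquare (sym b≡-1) sq))
        where
        open ≡-Reasoning
        ns-a′ : ¬ IsSquare a
        ns-a′ = subst (λ x → ¬ IsSquare x) (RP.-‿involutive a) (-1-square⇒-‿nonsquare sq ns-a)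
        1-b≡2 : 1# - b ≡ 1# + 1#
        1-b≡2 = begin
          1# - b                    ≡⟨ sym (R.*-identityˡ _) ⟩
          1# * (1# - b)             ≡⟨ cong (_* (1# - b)) (sym (a+a≡1 sq)) ⟩
          (a + a) * (1# - b)        ≡⟨ solve 2 (λ a b → (a :+ a) :* (1ₚ :- b) := con (+ 2) :* (a :+ b :* :- a)) refl a b ⟩
          (1# + 1#) * (a + b * - a) ≡⟨ cong (_*_ (1# + 1#)) (a+b*[-a]≡1 ns-a) ⟩
          (1# + 1#) * 1#            ≡⟨ R.*-identityʳ _ ⟩
          1# + 1#                   ∎
        b≡-1 : b ≡ - 1#
        b≡-1 = trans (solve 1 (λ b → b := 1ₚ :- (1ₚ :- b)) refl b)
                     (trans (cong (_-_ 1#) 1-b≡2) (solve 0 (1ₚ :- con (+ 2) := :- 1ₚ) refl))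

    -a-square : IsSquare (- a)
    -a-square with isSquare? (- 1#)
    ... | yes sq = -1-square⇒-a-square sq
    ... | no ns  = -1-nonsquare⇒-a-square ns

    a+a*[-a]≡1 : a + a * - a ≡ 1#
    a+a*[-a]≡1 = trans (sym (qmul-square a b (0-x≡-x a) -a-square)) a∙0≡1

    a*b≡1 : ¬ IsSquare (- 1#) → a * b ≡ 1#
    a*b≡1 ns = begin
      a * b         ≡⟨ cong (a *_) (sym (x+y≡1⇒1-x≡y (a+b≡1 ns))) ⟩
      a * (1# - a)  ≡⟨ solve 1 (λ a → a :* (1ₚ :- a) := a :+ a :* :- a) refl a ⟩
      a + a * - a   ≡⟨ a+a*[-a]≡1 ⟩
      1#            ∎
      where open ≡-Reasoning

    -1-square⇒Char3 : IsSquare (- 1#) → Char3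
    -1-square⇒Char3 sq = 4≡1⇒Char3 (begin
      1# + 1# + 1# + 1#                        ≡⟨ solve 0 (con (+ 4) := con (+ 4) :* 1ₚ) refl ⟩
      (1# + 1# + 1# + 1#) * 1#                 ≡⟨ cong (_*_ (1# + 1# + 1# + 1#)) (sym a+a*[-a]≡1) ⟩
      (1# + 1# + 1# + 1#) * (a + a * - a)      ≡⟨ solve 1 (λ a → con (+ 4) :* (a :+ a :* :- a)
                                                      := con (+ 2) :* (a :+ a) :- (a :+ a) :* (a :+ a)) refl a ⟩
      (1# + 1#) * (a + a) - (a + a) * (a + a)  ≡⟨ cong (λ s → (1# + 1#) * s - s * s) (a+a≡1 sq) ⟩
      (1# + 1#) * 1# - 1# * 1#                 ≡⟨ solve 0 (con (+ 2) :* 1ₚ :- 1ₚ :* 1ₚ := 1ₚ) refl ⟩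
      1#                                       ∎)
      where open ≡-Reasoning

    b+b≡1 : IsSquare (- 1#) → ∀ {w} → ¬ IsSquare w → b + b ≡ 1#
    b+b≡1 sq {w} ns-w with x*y≡0⇒x≡0∨y≡0 [b+b-1]w≡0
      where
      0∙w≡w∙0 : 0# + b * w ≡ w + b * - w
      0∙w≡w∙0 = trans (sym (qmul-nonsquare a b (solve 1 (λ w → w :- 0ₚ := w) refl w) ns-w))
                      (trans (comm 0# w) (qmul-nonsquare a b (0-x≡-x w) (-1-square⇒-‿nonsquare sq ns-w)))
      [b+b-1]w≡0 : (b + b - 1#) * w ≡ 0#
      [b+b-1]w≡0 = trans (solve 2 (λ b w → (b :+ b :- 1ₚ) :* w := (0ₚ :+ b :* w) :- (w :+ b :* :- w)) refl b w)
                         (x≡y⇒x-y≡0 0∙w≡w∙0)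
    ... | inj₁ b+b-1≡0 = x-y≡0⇒x≡y b+b-1≡0
    ... | inj₂ w≡0     = ⊥-elim (nonsquare⇒≢0 ns-w w≡0)

    steiner⇒roots : ¬ Char3 → ¬ IsSquare (- 1#) × a + b ≡ 1# × a * b ≡ 1#
    steiner⇒roots ¬3≡0 with isSquare? (- 1#)
    ... | yes sq = ⊥-elim (¬3≡0 (-1-square⇒Char3 sq))
    ... | no ns  = ns , a+b≡1 ns , a*b≡1 ns

    steiner⇒-1-1 : Char3 → a ≡ - 1# × b ≡ - 1#
    steiner⇒-1-1 3≡0 with isSquare? (- 1#)
    ... | yes sq = Char3⇒x+x≡1⇒x≡-1 3≡0 (a+a≡1 sq) ,
                   Char3⇒x+x≡1⇒x≡-1 3≡0 (b+b≡1 sq (proj₂ (nonsquare-exists (Char3⇒1≢-1 3≡0))))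
    ... | no ns  = A.Char3⇒u≡-1 3≡0 , B.Char3⇒u≡-1 3≡0
      where
      module A = SumProductOne (a+b≡1 ns) (a*b≡1 ns)
      module B = SumProductOne (trans (R.+-comm b a) (a+b≡1 ns)) (trans (R.*-comm b a) (a*b≡1 ns))

  QuadParams⇒≢1 : ∀ {a b} → QuadParams F a b → a ≢ 1#
  QuadParams⇒≢1 (_ , _ , _ , χ[1-a]≢0) a≡1 = χ≢0⇒≢0 χ[1-a]≢0 (x≡y⇒x-y≡0 (sym a≡1))

  QuadParams⇒nonsquare : ∀ {a b} → QuadParams F a b → ¬ IsSquare a → ¬ IsSquare b
  QuadParams⇒nonsquare (χa≡χb , _) ns-a = χ≡-1⇒nonsquare (trans (sym χa≡χb) (nonsquare⇒χ≡-1 ns-a))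

  module SteinerNecessity {a b} (qp : QuadParams F a b) (st : IsSteiner (qmul F a b)) =
    Necessity (QuadParams⇒≢1 qp) (QuadParams⇒nonsquare qp) (proj₁ (proj₂ (proj₂ st))) (proj₂ (proj₂ (proj₂ st)))

  Char3⇒steiner⇔-1-1 : Char3 → ∀ {a b} → QuadParams F a b → IsSteiner (qmul F a b) ⇔ (a ≡ - 1# × b ≡ - 1#)
  Char3⇒steiner⇔-1-1 3≡0 qp = mk⇔ (λ st → SteinerNecessity.steiner⇒-1-1 qp st 3≡0)
    λ (a≡-1 , b≡-1) → subst₂ (λ a b → IsSteiner (qmul F a b)) (sym a≡-1) (sym b≡-1) (steiner-char3 3≡0)

  Char3⇒steiner⇒affine : Char3 → ∀ {a b} → QuadParams F a b → IsSteiner (qmul F a b) → InducedByAffineSTS F (qmul F a b)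
  Char3⇒steiner⇒affine 3≡0 qp st with SteinerNecessity.steiner⇒-1-1 qp st 3≡0
  ... | a≡-1 , b≡-1 = subst₂ (λ a b → InducedByAffineSTS F (qmul F a b)) (sym a≡-1) (sym b≡-1) (affine-char3 3≡0)

  ¬Char3⇒steiner⇔roots : ¬ Char3 → ∀ {a b} → QuadParams F a b →
    IsSteiner (qmul F a b) ⇔ (a * b ≡ 1# × a + b ≡ 1# × χ (- 1#) ≡ -[1+ 0 ])
  ¬Char3⇒steiner⇔roots ¬3≡0 qp = mk⇔
    (λ st → let (ns , a+b≡1 , a*b≡1) = SteinerNecessity.steiner⇒roots qp st ¬3≡0 in a*b≡1 , a+b≡1 , nonsquare⇒χ≡-1 ns)
    (λ (a*b≡1 , a+b≡1 , χ[-1]≡-1) → steiner-of-roots a+b≡1 a*b≡1 (χ≡-1⇒nonsquare χ[-1]≡-1))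

  roots-invariants : ¬ Char3 → ∀ {a b} → a * b ≡ 1# × a + b ≡ 1# × χ (- 1#) ≡ -[1+ 0 ] →
    a ≢ b × a * b ≡ 1# × a + b ≡ 1# × a - a * a ≡ 1# × b - b * b ≡ 1#
    × - (a * a * a) ≡ 1# × - (b * b * b) ≡ 1#
    × χ a ≡ -[1+ 0 ] × χ b ≡ -[1+ 0 ] × χ (1# - a) ≡ -[1+ 0 ]
    × χ (1# - b) ≡ -[1+ 0 ] × χ (- 1#) ≡ -[1+ 0 ]
  roots-invariants ¬3≡0 {a} {b} (a*b≡1 , a+b≡1 , χ[-1]≡-1) =
    A.¬Char3⇒u≢v ¬3≡0 , a*b≡1 , a+b≡1 , A.u-u*u≡1 , B.u-u*u≡1 , A.-u*u*u≡1 , B.-u*u*u≡1 ,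
    χa≡-1 , χb≡-1 , trans (cong χ A.1-u≡v) χb≡-1 , trans (cong χ B.1-u≡v) χa≡-1 , χ[-1]≡-1
    where
    module A = SumProductOne a+b≡1 a*b≡1
    module B = SumProductOne (trans (R.+-comm b a) a+b≡1) (trans (R.*-comm b a) a*b≡1)
    χa≡-1 : χ a ≡ -[1+ 0 ]
    χa≡-1 = nonsquare⇒χ≡-1 (A.-1-nonsquare⇒nonsquare (χ≡-1⇒nonsquare χ[-1]≡-1))
    χb≡-1 : χ b ≡ -[1+ 0 ]
    χb≡-1 = nonsquare⇒χ≡-1 (B.-1-nonsquare⇒nonsquare (χ≡-1⇒nonsquare χ[-1]≡-1))

  steiner-unique : ∀ {a b c d} → QuadParams F a b → IsSteiner (qmul F a b) → a ≢ b → QuadParams F c d →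
    (IsSteiner (qmul F c d) ⇔ SamePair a b c d) × (IsSteiner (qmul F c d) → qmul F a b ≅M qmul F c d)
  steiner-unique {a} {b} {c} {d} qp st a≢b qp′ = mk⇔ steiner⇒samePair samePair⇒steiner , samePair⇒≅ ∘ steiner⇒samePair
    where
    ¬3≡0 : ¬ Char3
    ¬3≡0 3≡0 with SteinerNecessity.steiner⇒-1-1 qp st 3≡0
    ... | a≡-1 , b≡-1 = a≢b (trans a≡-1 (sym b≡-1))
    roots : ¬ IsSquare (- 1#) × a + b ≡ 1# × a * b ≡ 1#
    roots = SteinerNecessity.steiner⇒roots qp st ¬3≡0
    ns : ¬ IsSquare (- 1#)
    ns = proj₁ roots
    a+b≡1 : a + b ≡ 1#
    a+b≡1 = proj₁ (proj₂ roots)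
    a*b≡1 : a * b ≡ 1#
    a*b≡1 = proj₂ (proj₂ roots)

    steiner⇒samePair : IsSteiner (qmul F c d) → SamePair a b c d
    steiner⇒samePair st′ with SteinerNecessity.steiner⇒roots qp′ st′ ¬3≡0
    ... | _ , c+d≡1 , c*d≡1 = SumProductOne.pair-unique a+b≡1 a*b≡1 c+d≡1 c*d≡1

    samePair⇒steiner : SamePair a b c d → IsSteiner (qmul F c d)
    samePair⇒steiner (inj₁ (a≡c , b≡d)) = subst₂ (λ c d → IsSteiner (qmul F c d)) a≡c b≡d st
    samePair⇒steiner (inj₂ (a≡d , b≡c)) = subst₂ (λ c d → IsSteiner (qmul F c d)) b≡c a≡d
      (steiner-of-roots (trans (R.+-comm b a) a+b≡1) (trans (R.*-comm b a) a*b≡1) ns)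

    samePair⇒≅ : SamePair a b c d → qmul F a b ≅M qmul F c d
    samePair⇒≅ (inj₁ (a≡c , b≡d)) = subst₂ (λ c d → qmul F a b ≅M qmul F c d) a≡c b≡d (↔-refl , λ _ _ → refl)
    samePair⇒≅ (inj₂ (a≡d , b≡c)) = subst₂ (λ c d → qmul F a b ≅M qmul F c d) b≡c a≡d (qmul-swap-≅ a b ns)

lemma2p7 : (F : FiniteField) → FiniteField.OddOrder F →
    let open FiniteField F in
    (a b : Carrier) → QuadParams F a b →
    -- characteristic 3
    (Char3 →
      (IsSteiner (qmul F a b) ⇔ (a ≡ - 1# × b ≡ - 1#))
      × (IsSteiner (qmul F a b) → InducedByAffineSTS F (qmul F a b)))
    -- characteristic ≠ 3
    × (¬ Char3 →
      (IsSteiner (qmul F a b) ⇔ (a * b ≡ 1# × a + b ≡ 1# × χ (- 1#) ≡ -[1+ 0 ]))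
      × (IsSteiner (qmul F a b) →
          ¬ (a ≡ b)
          × a * b ≡ 1# × a + b ≡ 1# × a - a * a ≡ 1# × b - b * b ≡ 1#
          × - (a * a * a) ≡ 1# × - (b * b * b) ≡ 1#
          × χ a ≡ -[1+ 0 ] × χ b ≡ -[1+ 0 ] × χ (1# - a) ≡ -[1+ 0 ]
          × χ (1# - b) ≡ -[1+ 0 ] × χ (- 1#) ≡ -[1+ 0 ]))
    -- uniqueness among Steiner quadratic quasigroups with distinct parameters
    × (IsSteiner (qmul F a b) → ¬ (a ≡ b) →
        (c d : Carrier) → QuadParams F c d → ¬ (c ≡ d) →
        (IsSteiner (qmul F c d) ⇔ SamePair a b c d)
        × (IsSteiner (qmul F c d) → qmul F a b ≅M qmul F c d))
lemma2p7 F _ a b qp =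
  (λ 3≡0 → Char3⇒steiner⇔-1-1 3≡0 qp , Char3⇒steiner⇒affine 3≡0 qp) ,
  (λ ¬3≡0 → ¬Char3⇒steiner⇔roots ¬3≡0 qp ,
            roots-invariants ¬3≡0 ∘ Equivalence.to (¬Char3⇒steiner⇔roots ¬3≡0 qp)) ,
  (λ st a≢b c d qp′ _ → steiner-unique qp st a≢b qp′)
  where
  open QuadraticQuasigroupProperties F
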